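{- Let $n\geq 5$ and let $P=(Y,X,Z)$ be a path of length two in $AQ_n$ (so $X$ is adjacent to both $Y$ and $Z$, and $Y\neq Z$). Then $|N_{AQ_n}(P)|\geq 6n-17$ and $|N_{AQ_n}(X)\cap N_{AQ_n}(Y)\cap N_{AQ_n}(Z)|\leq 1$. Furthermore, if $Z=\overline{X}_n$, then $|N_{AQ_n}(P)|\geq 6n-15$.
   Context: The $n$-dimensional augmented cube $AQ_n$ has as vertex set all $n$-bit binary strings $X=x_nx_{n-1}\cdots x_1$. For $1\le i\le n$ let $X_i=x_n\cdots x_{i+1}\bar x_i x_{i-1}\cdots x_1$ (flip bit $i$) and $\overline{X}_i=x_n\cdots x_{i+1}\bar x_i\bar x_{i-1}\cdots\bar x_1$ (flip bits $i,i-1,\dots,1$). Two distinct vertices $X,Y$ are adjacent iff $Y=X_i$ for some $1\le i\le n$ or $Y=\overline{X}_i$ for some $2\le i\le n$. $N_{AQ_n}(U)$ denotes the set of neighbors of a vertex $U$, and for a subgraph $T$, $N_{AQ_n}(T)=\bigcup_{U\in V(T)}N_{AQ_n}(U)\setminus V(T)$. -}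

module Defs where

open import Data.Nat using (ℕ; zero; suc; _≤ᵇ_)
open import Data.Bool using (Bool; true; false; not; if_then_else_)
open import Data.Bool.Properties using () renaming (_≟_ to _≟ᵇ_)
open import Data.Fin using (Fin; toℕ)
open import Data.Fin.Properties using (any?)
open import Data.Vec using (Vec; []; _∷_; lookup; tabulate; updateAt)
open import Data.Vec.Properties using (≡-dec)
open import Data.List using (List; [_]; map; _++_; filter; length)
open import Data.Product using (Σ; ∃; _×_; _,_)
open import Data.Sum using (_⊎_)
open import Relation.Nullary using (¬_; Dec; yes; no)
open import Relation.Nullary.Decidable using (_×-dec_; _⊎-dec_; ¬?)
open import Relation.Binary.PropositionalEquality using (_≡_)
open import Data.Nat using (_≤_)
import Data.Nat.Properties as ℕP

-- A vertex of AQ_n: an n-bit string.  Bit x_i (1 ≤ i ≤ n) is stored at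
-- position k : Fin n with toℕ k = i - 1.
Vertex : ℕ → Set
Vertex n = Vec Bool n

flipBit : ∀ {n} → Fin n → Vertex n → Vertex n
flipBit k X = updateAt X k not

-- overline X_i : flip bits i, i-1, ..., 1
flipUpTo : ∀ {n} → Fin n → Vertex n → Vertex n
flipUpTo k X = tabulate λ j → if toℕ j ≤ᵇ toℕ k then not (lookup X j) else lookup X j

Adj : ∀ {n} → Vertex n → Vertex n → Set
Adj {n} X Y = ¬ (X ≡ Y) ×
  ((Σ (Fin n) λ k → Y ≡ flipBit k X) ⊎ (Σ (Fin n) λ k → (1 ≤ toℕ k) × (Y ≡ flipUpTo k X)))

_≟V_ : ∀ {n} (X Y : Vertex n) → Dec (X ≡ Y)
_≟V_ = ≡-dec _≟ᵇ_

adj? : ∀ {n} (X Y : Vertex n) → Dec (Adj X Y)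
adj? X Y = ¬? (X ≟V Y) ×-dec
  (any? (λ k → Y ≟V flipBit k X) ⊎-dec any? (λ k → (1 ℕP.≤? toℕ k) ×-dec (Y ≟V flipUpTo k X)))

allVertices : (n : ℕ) → List (Vertex n)
allVertices zero = [ [] ]
allVertices (suc n) = map (false ∷_) (allVertices n) ++ map (true ∷_) (allVertices n)

InNbhdPath : ∀ {n} → Vertex n → Vertex n → Vertex n → Vertex n → Set
InNbhdPath Y X Z W = (¬ (W ≡ Y) × ¬ (W ≡ X) × ¬ (W ≡ Z)) × (Adj Y W ⊎ Adj X W ⊎ Adj Z W)

inNbhdPath? : ∀ {n} (Y X Z W : Vertex n) → Dec (InNbhdPath Y X Z W)
inNbhdPath? Y X Z W =
  (¬? (W ≟V Y) ×-dec ¬? (W ≟V X) ×-dec ¬? (W ≟V Z)) ×-dec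
  (adj? Y W ⊎-dec adj? X W ⊎-dec adj? Z W)

nbhdPathSize : ∀ {n} → Vertex n → Vertex n → Vertex n → ℕ
nbhdPathSize {n} Y X Z = length (filter (inNbhdPath? Y X Z) (allVertices n))

InCommon : ∀ {n} → Vertex n → Vertex n → Vertex n → Vertex n → Set
InCommon X Y Z W = Adj X W × Adj Y W × Adj Z W

inCommon? : ∀ {n} (X Y Z W : Vertex n) → Dec (InCommon X Y Z W)
inCommon? X Y Z W = adj? X W ×-dec adj? Y W ×-dec adj? Z W

commonSize : ∀ {n} → Vertex n → Vertex n → Vertex n → ℕ
commonSize {n} X Y Z = length (filter (inCommon? X Y Z) (allVertices n))

-- In the coordinates W ↦ diff (X ⊕ W), where bit i of diff u is u_i xor u_{i+1},
-- AQ_n becomes the Cayley graph of 𝔽₂ⁿ whose generators are the vectors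
-- supported on one bit or on two adjacent bits; X goes to 𝟎 and Y, Z go to
-- distinct generators a, b.  Split the vertices by their lowest bit x_1.  Where it
-- agrees with that of a centre, the centre sees the same configuration one
-- dimension lower; where it differs, the centre sees exactly the two lifts of its
-- tail.  So while 𝟎, a, b all have lowest bit 0 and distinct tails, the
-- neighbourhood of the path a–𝟎–b gains 6 vertices per dimension.  Once a centre
-- has lowest bit 1 the count is bounded directly by |G| = 2n - 1 and by the bound
-- 4n - 8 for the neighbourhood of an edge, proved the same way; the worst such
-- configuration gives 6n - 17, and it cannot occur when b = unit (n - 1), i.e.
-- Z = overline X_n.  The same splitting shows that common neighbours of 𝟎, a, b
-- agree: below the lowest bit where a centre is nonzero everything lives in the
-- span of the two lowest unit vectors.

module Submission where

open import Defs

open import Algebra.Bundles using (CommutativeRing)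
import Algebra.Properties.CommutativeSemigroup as CommSemigroupProperties
open import Data.Bool using (Bool; true; false; not; _xor_; if_then_else_)
open import Data.Bool.Properties
  using (¬-not; not-injective; xor-∧-commutativeRing; xor-comm; xor-assoc; xor-identityˡ; xor-identityʳ; xor-same)
open import Data.Empty using (⊥; ⊥-elim)
open import Data.Fin using (Fin; zero; suc; toℕ; fromℕ)
open import Data.Fin.Properties using (toℕ-injective; toℕ-fromℕ)
open import Data.List using ([]; _∷_; length; filter; map; _++_)
open import Data.List.Properties using (filter-++; length-++)
open import Data.List.Relation.Unary.All as All using (All; []; _∷_)
open import Data.List.Relation.Unary.Unique.Propositional using (Unique; []; _∷_)
open import Data.Nat using (ℕ; zero; suc; _+_; _*_; _∸_; _≤_; _≤ᵇ_; z≤n; s≤s)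
open import Data.Nat.Properties
  using (≤-refl; ≤-trans; ≤-reflexive; +-mono-≤; +-monoˡ-≤; +-monoʳ-≤; +-comm; +-assoc; *-suc; *-distribʳ-+;
         suc-injective; m≤n+o⇒m∸n≤o; m≤m+n; m≤n+m; +-commutativeSemigroup; module ≤-Reasoning)
open import Data.Product using (∃; _×_; _,_; proj₂)
open import Data.Sum using (_⊎_; inj₁; inj₂; [_,_]′; swap) renaming (map to ⊎-map)
open import Data.Vec using ([]; _∷_; replicate; zipWith; lookup)
open import Data.Vec.Properties
  using (∷-injectiveˡ; ∷-injectiveʳ; zipWith-comm; zipWith-assoc; zipWith-identityˡ; zipWith-identityʳ;
         tabulate-cong; tabulate∘lookup)
open import Function using (_∘_; _∘₂_; id)
open import Level using (0ℓ)
open import Relation.Binary.PropositionalEquality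
open import Relation.Nullary using (¬_; Dec; yes; no; does)
open import Relation.Nullary.Decidable using (map′; _×-dec_; _⊎-dec_; ¬?)
open import Relation.Unary using (Pred; Decidable; _⊆_)
open import Relation.Unary.Properties using (_∩?_; ∁?)

open import Algebra.Properties.Group (CommutativeRing.+-group xor-∧-commutativeRing)
  using () renaming (∙-cancelʳ to xor-cancelʳ)
open CommSemigroupProperties (CommutativeRing.+-commutativeSemigroup xor-∧-commutativeRing)
  using () renaming (interchange to xor-interchange)
open CommSemigroupProperties +-commutativeSemigroup
  using (x∙yz≈y∙xz) renaming (interchange to +-interchange)

infixl 6 _⊕_

𝟎 : ∀ {n} → Vertex n
𝟎 = replicate _ false

_⊕_ : ∀ {n} → Vertex n → Vertex n → Vertex n
_⊕_ = zipWith _xor_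

⊕-identityˡ : ∀ {n} (u : Vertex n) → 𝟎 ⊕ u ≡ u
⊕-identityˡ = zipWith-identityˡ xor-identityˡ

⊕-identityʳ : ∀ {n} (u : Vertex n) → u ⊕ 𝟎 ≡ u
⊕-identityʳ = zipWith-identityʳ xor-identityʳ

⊕-comm : ∀ {n} (u v : Vertex n) → u ⊕ v ≡ v ⊕ u
⊕-comm = zipWith-comm xor-comm

⊕-assoc : ∀ {n} (u v w : Vertex n) → u ⊕ v ⊕ w ≡ u ⊕ (v ⊕ w)
⊕-assoc = zipWith-assoc xor-assoc

⊕-self : ∀ {n} (u : Vertex n) → u ⊕ u ≡ 𝟎
⊕-self [] = refl
⊕-self (x ∷ u) = cong₂ _∷_ (xor-same x) (⊕-self u)

⊕-cancelˡ : ∀ {n} (u v : Vertex n) → u ⊕ (u ⊕ v) ≡ v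
⊕-cancelˡ u v = begin
  u ⊕ (u ⊕ v) ≡⟨ ⊕-assoc u u v ⟨
  u ⊕ u ⊕ v   ≡⟨ cong (_⊕ v) (⊕-self u) ⟩
  𝟎 ⊕ v       ≡⟨ ⊕-identityˡ v ⟩
  v           ∎
  where open ≡-Reasoning

⊕-cancel-common : ∀ {n} (u v w : Vertex n) → (u ⊕ v) ⊕ (u ⊕ w) ≡ v ⊕ w
⊕-cancel-common u v w = begin
  u ⊕ v ⊕ (u ⊕ w)   ≡⟨ cong (_⊕ (u ⊕ w)) (⊕-comm u v) ⟩
  v ⊕ u ⊕ (u ⊕ w)   ≡⟨ ⊕-assoc v u (u ⊕ w) ⟩
  v ⊕ (u ⊕ (u ⊕ w)) ≡⟨ cong (v ⊕_) (⊕-cancelˡ u w) ⟩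
  v ⊕ w             ∎
  where open ≡-Reasoning

-- AQ_n as a Cayley graph of 𝔽₂ⁿ

head₀ : ∀ {n} → Vertex n → Bool
head₀ [] = false
head₀ (x ∷ _) = x

head₀-⊕ : ∀ {n} (u v : Vertex n) → head₀ (u ⊕ v) ≡ head₀ u xor head₀ v
head₀-⊕ [] [] = refl
head₀-⊕ (x ∷ u) (y ∷ v) = refl

-- Bit i of diff u is u_i xor u_{i+1}, the missing bit u_{n+1} being read as 0
-- (the junk value of head₀ []).  diff sends ones≤ k, the bits flipped by
-- overline X_{k+1}, to unit k, and unit k to unit k + unit (k - 1) for k ≥ 1.
diff : ∀ {n} → Vertex n → Vertex n
diff [] = []
diff (x ∷ u) = (x xor head₀ u) ∷ diff u

diff-⊕ : ∀ {n} (u v : Vertex n) → diff (u ⊕ v) ≡ diff u ⊕ diff v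
diff-⊕ [] [] = refl
diff-⊕ (x ∷ u) (y ∷ v) = cong₂ _∷_
  (trans (cong ((x xor y) xor_) (head₀-⊕ u v)) (xor-interchange x y (head₀ u) (head₀ v)))
  (diff-⊕ u v)

diff-injective : ∀ {n} {u v : Vertex n} → diff u ≡ diff v → u ≡ v
diff-injective {u = []} {[]} _ = refl
diff-injective {u = x ∷ u} {y ∷ v} e with diff-injective (∷-injectiveʳ e)
... | refl = cong (_∷ u) (xor-cancelʳ (head₀ u) x y (∷-injectiveˡ e))

diff-𝟎 : ∀ {n} → diff (𝟎 {n}) ≡ 𝟎
diff-𝟎 {zero} = refl
diff-𝟎 {suc zero} = refl
diff-𝟎 {suc (suc n)} = cong (false ∷_) diff-𝟎

diff-e₀ : ∀ {n} → diff (true ∷ 𝟎 {n}) ≡ true ∷ 𝟎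
diff-e₀ {zero} = refl
diff-e₀ {suc n} = cong (true ∷_) diff-𝟎

unit : ∀ {n} → Fin n → Vertex n
unit zero = true ∷ 𝟎
unit (suc k) = false ∷ unit k

ones≤ : ∀ {n} → Fin n → Vertex n
ones≤ zero = true ∷ 𝟎
ones≤ (suc k) = true ∷ ones≤ k

not≡xor-true : ∀ x → not x ≡ x xor true
not≡xor-true false = refl
not≡xor-true true = refl

flipBit-⊕ : ∀ {n} (k : Fin n) (X : Vertex n) → flipBit k X ≡ X ⊕ unit k
flipBit-⊕ zero (x ∷ X) = cong₂ _∷_ (not≡xor-true x) (sym (⊕-identityʳ X))
flipBit-⊕ (suc k) (x ∷ X) = cong₂ _∷_ (sym (xor-identityʳ x)) (flipBit-⊕ k X)

suc≤ᵇsuc : ∀ m n → (suc m ≤ᵇ suc n) ≡ (m ≤ᵇ n)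
suc≤ᵇsuc zero n = refl
suc≤ᵇsuc (suc m) n = refl

flipUpTo-⊕ : ∀ {n} (k : Fin n) (X : Vertex n) → flipUpTo k X ≡ X ⊕ ones≤ k
flipUpTo-⊕ zero (x ∷ X) = cong₂ _∷_ (not≡xor-true x) (trans (tabulate∘lookup X) (sym (⊕-identityʳ X)))
flipUpTo-⊕ (suc k) (x ∷ X) = cong₂ _∷_ (not≡xor-true x)
  (trans (tabulate-cong λ j → cong (λ b → if b then not (lookup X j) else lookup X j) (suc≤ᵇsuc (toℕ j) (toℕ k)))
         (flipUpTo-⊕ k X))

diff-ones≤ : ∀ {n} (k : Fin n) → diff (ones≤ k) ≡ unit k
diff-ones≤ zero = diff-e₀
diff-ones≤ (suc zero) = cong (false ∷_) diff-e₀
diff-ones≤ (suc (suc k)) = cong (false ∷_) (diff-ones≤ (suc k))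

-- The images under diff of the flip vectors unit k and ones≤ k (k ≥ 1).
data IsGen : ∀ {n} → Vertex n → Set where
  single : ∀ {n} → IsGen (true ∷ 𝟎 {n})
  pair   : ∀ {n} → IsGen (true ∷ true ∷ 𝟎 {n})
  shift  : ∀ {n} {g : Vertex n} → IsGen g → IsGen (false ∷ g)

unshift : ∀ {n} {g : Vertex n} → IsGen (false ∷ g) → IsGen g
unshift (shift g) = g

¬IsGen-𝟎 : ∀ {n} → ¬ IsGen (𝟎 {n})
¬IsGen-𝟎 {suc n} (shift g) = ¬IsGen-𝟎 g

IsGen⇒≢𝟎 : ∀ {n} {g : Vertex n} → IsGen g → g ≢ 𝟎
IsGen⇒≢𝟎 g refl = ¬IsGen-𝟎 g

isGen? : ∀ {n} → Decidable (IsGen {n})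
isGen? [] = no λ ()
isGen? (false ∷ v) = map′ shift unshift (isGen? v)
isGen? (true ∷ []) = yes single
isGen? (true ∷ false ∷ v) = map′ (λ { refl → single }) (λ { single → refl }) (v ≟V 𝟎)
isGen? (true ∷ true ∷ v) = map′ (λ { refl → pair }) (λ { pair → refl }) (v ≟V 𝟎)

lowGen : ∀ {n} x → IsGen (true ∷ x ∷ 𝟎 {n})
lowGen false = single
lowGen true = pair

lowGen-⊕-self : ∀ {n} x (t : Vertex n) → IsGen (true ∷ x ∷ (t ⊕ t))
lowGen-⊕-self x t = subst (λ u → IsGen (true ∷ x ∷ u)) (sym (⊕-self t)) (lowGen x)

unit-gen : ∀ {n} (k : Fin n) → IsGen (unit k)
unit-gen zero = single
unit-gen (suc k) = shift (unit-gen k)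

diff-unit-gen : ∀ {n} (k : Fin n) → IsGen (diff (unit k))
diff-unit-gen zero = subst IsGen (sym diff-e₀) single
diff-unit-gen (suc zero) = subst (λ t → IsGen (true ∷ t)) (sym diff-e₀) pair
diff-unit-gen (suc (suc k)) = shift (diff-unit-gen (suc k))

low-tail : ∀ {m} {x} {t : Vertex m} → IsGen (true ∷ x ∷ t) → t ≡ 𝟎
low-tail single = refl
low-tail pair = refl

low-gens-adjacent : ∀ {m} {a b : Vertex m} → IsGen (true ∷ a) → IsGen (true ∷ b) → a ≢ b → IsGen (a ⊕ b)
low-gens-adjacent single single a≢b = ⊥-elim (a≢b refl)
low-gens-adjacent single pair _ = subst (λ u → IsGen (true ∷ u)) (sym (⊕-self 𝟎)) single
low-gens-adjacent pair single _ = subst (λ u → IsGen (true ∷ u)) (sym (⊕-self 𝟎)) single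
low-gens-adjacent pair pair a≢b = ⊥-elim (a≢b refl)

_~_ : ∀ {n} → Vertex n → Vertex n → Set
u ~ v = IsGen (u ⊕ v)

~⇒≢ : ∀ {n} {u v : Vertex n} → u ~ v → u ≢ v
~⇒≢ {u = u} u~u refl = ¬IsGen-𝟎 (subst IsGen (⊕-self u) u~u)

~-sym : ∀ {n} (u v : Vertex n) → u ~ v → v ~ u
~-sym u v = subst IsGen (⊕-comm u v)

gen-decode : ∀ {n} {g : Vertex n} → IsGen g →
  (∃ λ k → g ≡ diff (unit k)) ⊎ (∃ λ k → 1 ≤ toℕ k × g ≡ unit k)
gen-decode single = inj₁ (zero , sym diff-e₀)
gen-decode pair = inj₁ (suc zero , cong (true ∷_) (sym diff-e₀))
gen-decode (shift g) with gen-decode g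
... | inj₁ (zero , e) = inj₂ (suc zero , s≤s z≤n , cong (false ∷_) (trans e diff-e₀))
... | inj₁ (suc k , e) = inj₁ (suc (suc k) , cong (false ∷_) e)
... | inj₂ (k , _ , e) = inj₂ (suc k , s≤s z≤n , cong (false ∷_) e)

coords : ∀ {n} → Vertex n → Vertex n → Vertex n
coords X W = diff (X ⊕ W)

coords-self : ∀ {n} (X : Vertex n) → coords X X ≡ 𝟎
coords-self X = trans (cong diff (⊕-self X)) diff-𝟎

coords-⊕ : ∀ {n} (X U W : Vertex n) → coords X U ⊕ coords X W ≡ diff (U ⊕ W)
coords-⊕ X U W = trans (sym (diff-⊕ (X ⊕ U) (X ⊕ W))) (cong diff (⊕-cancel-common X U W))

coords-injective : ∀ {n} (X : Vertex n) {U W} → coords X U ≡ coords X W → U ≡ W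
coords-injective X {U} {W} e =
  trans (sym (⊕-cancelˡ X U)) (trans (cong (X ⊕_) (diff-injective e)) (⊕-cancelˡ X W))

coords-flipBit : ∀ {n} (X : Vertex n) k → coords X (flipBit k X) ≡ diff (unit k)
coords-flipBit X k = cong diff (trans (cong (X ⊕_) (flipBit-⊕ k X)) (⊕-cancelˡ X (unit k)))

coords-flipUpTo : ∀ {n} (X : Vertex n) k → coords X (flipUpTo k X) ≡ unit k
coords-flipUpTo X k =
  trans (cong diff (trans (cong (X ⊕_) (flipUpTo-⊕ k X)) (⊕-cancelˡ X (ones≤ k)))) (diff-ones≤ k)

adj⇒gen : ∀ {n} {X W : Vertex n} → Adj X W → IsGen (coords X W)
adj⇒gen {X = X} (_ , inj₁ (k , refl)) = subst IsGen (sym (coords-flipBit X k)) (diff-unit-gen k)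
adj⇒gen {X = X} (_ , inj₂ (k , _ , refl)) = subst IsGen (sym (coords-flipUpTo X k)) (unit-gen k)

gen⇒adj : ∀ {n} {X W : Vertex n} → IsGen (coords X W) → Adj X W
gen⇒adj {X = X} {W} g =
  X≢W ,
  ⊎-map (λ (k , e) → k , coords-injective X (trans e (sym (coords-flipBit X k))))
        (λ (k , 1≤k , e) → k , 1≤k , coords-injective X (trans e (sym (coords-flipUpTo X k))))
        (gen-decode g)
  where
  X≢W : X ≢ W
  X≢W refl = ¬IsGen-𝟎 (subst IsGen (coords-self X) g)

adj⇒coords~ : ∀ {n} (X : Vertex n) {U W} → Adj U W → coords X U ~ coords X W
adj⇒coords~ X {U} {W} = subst IsGen (sym (coords-⊕ X U W)) ∘ adj⇒gen

coords~⇒adj : ∀ {n} (X : Vertex n) {U W} → coords X U ~ coords X W → Adj U W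
coords~⇒adj X {U} {W} = gen⇒adj ∘ subst IsGen (coords-⊕ X U W)

-- Counting vertices

sum : ∀ n → (Vertex n → ℕ) → ℕ
sum zero f = f []
sum (suc n) f = sum n (λ v → f (false ∷ v)) + sum n (λ v → f (true ∷ v))

sum-mono : ∀ n {f g : Vertex n → ℕ} → (∀ v → f v ≤ g v) → sum n f ≤ sum n g
sum-mono zero f≤g = f≤g []
sum-mono (suc n) f≤g = +-mono-≤ (sum-mono n (f≤g ∘ (false ∷_))) (sum-mono n (f≤g ∘ (true ∷_)))

sum-cong : ∀ n {f g : Vertex n → ℕ} → (∀ v → f v ≡ g v) → sum n f ≡ sum n g
sum-cong zero f≡g = f≡g []
sum-cong (suc n) f≡g = cong₂ _+_ (sum-cong n (f≡g ∘ (false ∷_))) (sum-cong n (f≡g ∘ (true ∷_)))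

sum-+ : ∀ n (f g : Vertex n → ℕ) → sum n (λ v → f v + g v) ≡ sum n f + sum n g
sum-+ zero f g = refl
sum-+ (suc n) f g = trans
  (cong₂ _+_ (sum-+ n (f ∘ (false ∷_)) (g ∘ (false ∷_))) (sum-+ n (f ∘ (true ∷_)) (g ∘ (true ∷_))))
  (+-interchange (sum n (f ∘ (false ∷_))) (sum n (g ∘ (false ∷_)))
                 (sum n (f ∘ (true ∷_))) (sum n (g ∘ (true ∷_))))

sum-translate : ∀ {n} (c : Vertex n) (f : Vertex n → ℕ) → sum n (λ v → f (c ⊕ v)) ≡ sum n f
sum-translate [] f = refl
sum-translate (false ∷ c) f = cong₂ _+_ (sum-translate c (f ∘ (false ∷_))) (sum-translate c (f ∘ (true ∷_)))
sum-translate (true ∷ c) f = trans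
  (cong₂ _+_ (sum-translate c (f ∘ (true ∷_))) (sum-translate c (f ∘ (false ∷_))))
  (+-comm (sum _ (f ∘ (true ∷_))) (sum _ (f ∘ (false ∷_))))

sum-diff : ∀ n (f : Vertex n → ℕ) → sum n (f ∘ diff) ≡ sum n f
sum-diff zero f = refl
sum-diff (suc n) f = begin
  sum n (λ v → f (head₀ v ∷ diff v)) + sum n (λ v → f (not (head₀ v) ∷ diff v))
    ≡⟨ sum-+ n _ _ ⟨
  sum n (λ v → f (head₀ v ∷ diff v) + f (not (head₀ v) ∷ diff v))
    ≡⟨ sum-cong n (λ v → both-heads (head₀ v) (diff v)) ⟩
  sum n (λ v → f (false ∷ diff v) + f (true ∷ diff v))
    ≡⟨ sum-diff n (λ u → f (false ∷ u) + f (true ∷ u)) ⟩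
  sum n (λ u → f (false ∷ u) + f (true ∷ u))
    ≡⟨ sum-+ n _ _ ⟩
  sum n (f ∘ (false ∷_)) + sum n (f ∘ (true ∷_))
    ∎
  where
  open ≡-Reasoning
  both-heads : ∀ x u → f (x ∷ u) + f (not x ∷ u) ≡ f (false ∷ u) + f (true ∷ u)
  both-heads false u = refl
  both-heads true u = +-comm (f (true ∷ u)) (f (false ∷ u))

𝟙 : {P : Set} → Dec P → ℕ
𝟙 (yes _) = 1
𝟙 (no _) = 0

count : ∀ n {P : Pred (Vertex n) 0ℓ} → Decidable P → ℕ
count n P? = sum n (λ v → 𝟙 (P? v))

count-mono : ∀ n {P Q : Pred (Vertex n) 0ℓ} (P? : Decidable P) (Q? : Decidable Q) →
             P ⊆ Q → count n P? ≤ count n Q?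
count-mono n {P} {Q} P? Q? P⊆Q = sum-mono n λ v → 𝟙-mono (P? v) (Q? v)
  where
  𝟙-mono : ∀ {v} (p : Dec (P v)) (q : Dec (Q v)) → 𝟙 p ≤ 𝟙 q
  𝟙-mono (yes _) (yes _) = ≤-refl
  𝟙-mono (yes p) (no ¬q) = ⊥-elim (¬q (P⊆Q p))
  𝟙-mono (no _) _ = z≤n

count-translate : ∀ n {P : Pred (Vertex n) 0ℓ} (P? : Decidable P) (c : Vertex n) →
                  count n (λ v → P? (c ⊕ v)) ≡ count n P?
count-translate n P? c = sum-translate c (λ v → 𝟙 (P? v))

count-coords : ∀ n {P : Pred (Vertex n) 0ℓ} (P? : Decidable P) (X : Vertex n) →
               count n (P? ∘ coords X) ≡ count n P?
count-coords n P? X = trans (sum-translate X (λ u → 𝟙 (P? (diff u)))) (sum-diff n (λ u → 𝟙 (P? u)))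

count-≥-witness : ∀ n {P : Pred (Vertex n) 0ℓ} (P? : Decidable P) {x} → P x → 1 ≤ count n P?
count-≥-witness zero P? {[]} p with P? []
... | yes _ = ≤-refl
... | no ¬p = ⊥-elim (¬p p)
count-≥-witness (suc n) P? {false ∷ x} p =
  ≤-trans (count-≥-witness n (P? ∘ (false ∷_)) p) (m≤m+n _ _)
count-≥-witness (suc n) P? {true ∷ x} p =
  ≤-trans (count-≥-witness n (P? ∘ (true ∷_)) p) (m≤n+m _ _)

count-split : ∀ n {P Q : Pred (Vertex n) 0ℓ} (P? : Decidable P) (Q? : Decidable Q) →
              count n P? ≡ count n (P? ∩? Q?) + count n (P? ∩? ∁? Q?)
count-split n P? Q? = trans (sum-cong n λ v → 𝟙-split (P? v) (Q? v)) (sum-+ n _ _)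
  where
  𝟙-split : ∀ {A B : Set} (a? : Dec A) (b? : Dec B) → 𝟙 a? ≡ 𝟙 (a? ×-dec b?) + 𝟙 (a? ×-dec ¬? b?)
  𝟙-split (yes _) (yes _) = refl
  𝟙-split (yes _) (no _) = refl
  𝟙-split (no _) _ = refl

count-≥-unique : ∀ n {P : Pred (Vertex n) 0ℓ} (P? : Decidable P) {xs} →
                 Unique xs → All P xs → length xs ≤ count n P?
count-≥-unique n P? [] [] = z≤n
count-≥-unique n P? {x ∷ xs} (x∉xs ∷ unique) (px ∷ pxs) = ≤-trans
  (+-mono-≤ (count-≥-witness n (P? ∩? (_≟V x)) (px , refl))
            (count-≥-unique n (P? ∩? ∁? (_≟V x)) unique
              (All.zipWith (λ (py , x≢y) → py , ≢-sym x≢y) (pxs , x∉xs))))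
  (≤-reflexive (sym (count-split n P? (_≟V x))))

count-≥-lifts : ∀ m {P : Pred (Vertex (suc m)) 0ℓ} (P? : Decidable P) {ts} →
                Unique ts → (∀ x → All (λ t → P (x ∷ t)) ts) →
                length ts + length ts ≤ count (suc m) P?
count-≥-lifts m P? unique lifts = +-mono-≤
  (count-≥-unique m (P? ∘ (false ∷_)) unique (lifts false))
  (count-≥-unique m (P? ∘ (true ∷_)) unique (lifts true))

count-witness : ∀ n {P : Pred (Vertex n) 0ℓ} (P? : Decidable P) → 1 ≤ count n P? → ∃ P
count-witness zero P? h with P? []
count-witness zero P? h | yes p = [] , p
count-witness zero P? () | no _
count-witness (suc n) P? h with count n (P? ∘ (false ∷_)) in eq
... | zero = let v , p = count-witness n (P? ∘ (true ∷_)) h in true ∷ v , p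
... | suc _ = let v , p = count-witness n (P? ∘ (false ∷_)) (subst (1 ≤_) (sym eq) (s≤s z≤n))
              in false ∷ v , p

count-≤-one : ∀ n {P : Pred (Vertex n) 0ℓ} (P? : Decidable P) →
              (∀ {v w} → P v → P w → v ≡ w) → count n P? ≤ 1
count-≤-one zero P? _ with P? []
... | yes _ = ≤-refl
... | no _ = z≤n
count-≤-one (suc n) P? unique = +-≤-one
  (count-≤-one n (P? ∘ (false ∷_)) (∷-injectiveʳ ∘₂ unique))
  (count-≤-one n (P? ∘ (true ∷_)) (∷-injectiveʳ ∘₂ unique))
  λ 1≤a 1≤b → false≢true (∷-injectiveˡ
    (unique (proj₂ (count-witness n _ 1≤a)) (proj₂ (count-witness n _ 1≤b))))
  where
  false≢true : false ≢ true
  false≢true ()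
  +-≤-one : ∀ {a b} → a ≤ 1 → b ≤ 1 → (1 ≤ a → 1 ≤ b → ⊥) → a + b ≤ 1
  +-≤-one {zero} _ b≤1 _ = b≤1
  +-≤-one {suc zero} {zero} _ _ _ = ≤-refl
  +-≤-one {suc zero} {suc b} _ _ both = ⊥-elim (both (s≤s z≤n) (s≤s z≤n))
  +-≤-one {suc (suc a)} (s≤s ()) _ _

count-filter : ∀ n {P : Pred (Vertex n) 0ℓ} (P? : Decidable P) →
               length (filter P? (allVertices n)) ≡ count n P?
count-filter zero P? with P? []
... | yes _ = refl
... | no _ = refl
count-filter (suc n) P? = begin
  length (filter P? (map (false ∷_) vs ++ map (true ∷_) vs))
    ≡⟨ cong length (filter-++ P? (map (false ∷_) vs) (map (true ∷_) vs)) ⟩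
  length (filter P? (map (false ∷_) vs) ++ filter P? (map (true ∷_) vs))
    ≡⟨ length-++ (filter P? (map (false ∷_) vs)) ⟩
  length (filter P? (map (false ∷_) vs)) + length (filter P? (map (true ∷_) vs))
    ≡⟨ cong₂ _+_ (length-filter-map (false ∷_) vs) (length-filter-map (true ∷_) vs) ⟩
  length (filter (P? ∘ (false ∷_)) vs) + length (filter (P? ∘ (true ∷_)) vs)
    ≡⟨ cong₂ _+_ (count-filter n (P? ∘ (false ∷_))) (count-filter n (P? ∘ (true ∷_))) ⟩
  count (suc n) P?
    ∎
  where
  open ≡-Reasoning
  vs = allVertices n
  length-filter-map : ∀ f xs → length (filter P? (map f xs)) ≡ length (filter (P? ∘ f) xs)
  length-filter-map f [] = refl
  length-filter-map f (x ∷ xs) with does (P? (f x))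
  ... | true = cong suc (length-filter-map f xs)
  ... | false = length-filter-map f xs

≤-next-dimension : ∀ k n {p x y c d} c' → k * n ≤ p + c → p ≤ x → d ≤ y → k + c ≤ d + c' →
                   k * suc n ≤ x + y + c'
≤-next-dimension k n {p} {x} {y} {c} {d} c' kn≤p+c p≤x d≤y slack = begin
  k * suc n    ≡⟨ *-suc k n ⟩
  k + k * n    ≤⟨ +-monoʳ-≤ k kn≤p+c ⟩
  k + (p + c)  ≡⟨ x∙yz≈y∙xz k p c ⟩
  p + (k + c)  ≤⟨ +-monoʳ-≤ p slack ⟩
  p + (d + c') ≡⟨ +-assoc p d c' ⟨
  p + d + c'   ≤⟨ +-monoˡ-≤ c' (+-mono-≤ p≤x d≤y) ⟩
  x + y + c'   ∎
  where open ≤-Reasoning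

≤-combine : ∀ {a b x y} c d → a ≤ x + c → b ≤ y + d → a + b ≤ x + y + (c + d)
≤-combine {x = x} {y} c d a≤x+c b≤y+d = ≤-trans (+-mono-≤ a≤x+c b≤y+d) (≤-reflexive (+-interchange x c y d))

gens+edge-bound : ∀ m c {g e p} → 2 * m ≤ g + 1 → 4 * m ≤ e + c → g + e ≤ p → 6 * suc m ≤ p + (7 + c)
gens+edge-bound m c {g} {e} {p} gens edge g+e≤p = begin
  6 * suc m                ≡⟨ trans (*-suc 6 m) (cong (6 +_) (*-distribʳ-+ m 2 4)) ⟩
  6 + (2 * m + 4 * m)      ≤⟨ +-monoʳ-≤ 6 (≤-combine 1 c gens edge) ⟩
  6 + (g + e + (1 + c))    ≡⟨ x∙yz≈y∙xz 6 (g + e) (1 + c) ⟩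
  g + e + (7 + c)          ≤⟨ +-monoˡ-≤ (7 + c) g+e≤p ⟩
  p + (7 + c)              ∎
  where open ≤-Reasoning

∸-bound : ∀ {k x y} c → k ≤ x + c → x ≤ y → k ∸ c ≤ y
∸-bound {k} {x} c k≤x+c x≤y =
  m≤n+o⇒m∸n≤o k c (≤-trans k≤x+c (≤-trans (≤-reflexive (+-comm x c)) (+-monoʳ-≤ c x≤y)))

-- Neighbourhoods in the Cayley graph

gens-lower : ∀ n → 2 * n ≤ count n isGen? + 1
gens-lower zero = z≤n
gens-lower (suc zero) = ≤-refl
gens-lower (suc (suc m)) = ≤-next-dimension 2 (suc m) 1 (gens-lower (suc m))
  (count-mono (suc m) isGen? (isGen? ∘ (false ∷_)) shift)
  (count-≥-lifts m (isGen? ∘ (true ∷_)) ([] ∷ []) (λ x → lowGen x ∷ []))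
  ≤-refl

EdgeNbhd : ∀ {n} → Vertex n → Pred (Vertex n) 0ℓ
EdgeNbhd b v = v ≢ 𝟎 × v ≢ b × (IsGen v ⊎ b ~ v)

edgeNbhd? : ∀ {n} (b : Vertex n) → Decidable (EdgeNbhd b)
edgeNbhd? b v = ¬? (v ≟V 𝟎) ×-dec ¬? (v ≟V b) ×-dec (isGen? v ⊎-dec isGen? (b ⊕ v))

edge-nbhd-head-true : ∀ m (b : Vertex m) → 4 * suc m ≤ count (suc m) (edgeNbhd? (true ∷ b)) + 6
edge-nbhd-head-true m b = begin
  4 * suc m                   ≡⟨ trans (*-suc 4 m) (cong (4 +_) (*-distribʳ-+ m 2 2)) ⟩
  4 + (2 * m + 2 * m)         ≤⟨ +-monoʳ-≤ 4 (≤-combine 1 1 (gens-lower m) (gens-lower m)) ⟩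
  4 + (gens + gens + 2)       ≡⟨ x∙yz≈y∙xz 4 (gens + gens) 2 ⟩
  gens + gens + 6             ≤⟨ +-monoˡ-≤ 6 (+-mono-≤ false-half true-half) ⟩
  count (suc m) (edgeNbhd? (true ∷ b)) + 6 ∎
  where
  open ≤-Reasoning
  gens = count m isGen?
  false-half : gens ≤ count m (edgeNbhd? (true ∷ b) ∘ (false ∷_))
  false-half = count-mono m _ _ λ g → IsGen⇒≢𝟎 (shift g) , (λ ()) , inj₁ (shift g)
  true-half : gens ≤ count m (edgeNbhd? (true ∷ b) ∘ (true ∷_))
  true-half = ≤-trans (≤-reflexive (sym (count-translate m isGen? b)))
    (count-mono m (isGen? ∘ (b ⊕_)) _ λ b~w →
      (λ ()) , ~⇒≢ b~w ∘ sym ∘ ∷-injectiveʳ , inj₂ (shift b~w))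

edge-nbhd-false-half : ∀ n (b : Vertex n) →
                       count n (edgeNbhd? b) ≤ count n (edgeNbhd? (false ∷ b) ∘ (false ∷_))
edge-nbhd-false-half n b = count-mono n _ _ λ (w≢𝟎 , w≢b , g) →
  w≢𝟎 ∘ ∷-injectiveʳ , w≢b ∘ ∷-injectiveʳ , ⊎-map shift shift g

edge-nbhd-true-half : ∀ m x₀ (t : Vertex m) {ts} → Unique ts → All (λ u → u ≡ 𝟎 ⊎ u ≡ t) ts →
                      length ts + length ts ≤ count (suc m) (edgeNbhd? (false ∷ x₀ ∷ t) ∘ (true ∷_))
edge-nbhd-true-half m x₀ t unique ts-ok =
  count-≥-lifts m (edgeNbhd? (false ∷ x₀ ∷ t) ∘ (true ∷_)) unique λ x → All.map (member x) ts-ok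
  where
  member : ∀ x {u} → u ≡ 𝟎 ⊎ u ≡ t → EdgeNbhd (false ∷ x₀ ∷ t) (true ∷ x ∷ u)
  member x (inj₁ refl) = (λ ()) , (λ ()) , inj₁ (lowGen x)
  member x (inj₂ refl) = (λ ()) , (λ ()) , inj₂ (lowGen-⊕-self (x₀ xor x) t)

edge-nbhd-lower : ∀ {n} {b : Vertex n} → IsGen b → 4 * n ≤ count n (edgeNbhd? b) + 8
edge-nbhd-lower {suc zero} {false ∷ []} (shift ())
edge-nbhd-lower {suc m} {true ∷ t} _ = ≤-trans (edge-nbhd-head-true m t) (+-monoʳ-≤ _ (m≤n+m 6 2))
edge-nbhd-lower {suc (suc m)} {false ∷ true ∷ t} _ = ≤-next-dimension 4 (suc m) 8
  (edge-nbhd-head-true m t)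
  (edge-nbhd-false-half (suc m) (true ∷ t))
  (edge-nbhd-true-half m true t ([] ∷ []) (inj₁ refl ∷ []))
  ≤-refl
edge-nbhd-lower {suc (suc m)} {false ∷ false ∷ t} (shift g) = ≤-next-dimension 4 (suc m) 8
  (edge-nbhd-lower g)
  (edge-nbhd-false-half (suc m) (false ∷ t))
  (edge-nbhd-true-half m false t (((IsGen⇒≢𝟎 (unshift g) ∘ sym) ∷ []) ∷ [] ∷ [])
    (inj₁ refl ∷ inj₂ refl ∷ []))
  ≤-refl

edge-nbhd-top : ∀ m → 4 * suc m ≤ count (suc m) (edgeNbhd? (unit (fromℕ m))) + 6
edge-nbhd-top zero = edge-nbhd-head-true 0 []
edge-nbhd-top (suc zero) = ≤-refl
edge-nbhd-top (suc (suc k)) = ≤-next-dimension 4 (suc (suc k)) 6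
  (edge-nbhd-top (suc k))
  (edge-nbhd-false-half (suc (suc k)) (unit (fromℕ (suc k))))
  (edge-nbhd-true-half (suc k) false (unit (fromℕ k)) (((IsGen⇒≢𝟎 (unit-gen _) ∘ sym) ∷ []) ∷ [] ∷ [])
    (inj₁ refl ∷ inj₂ refl ∷ []))
  ≤-refl

PathNbhd : ∀ {n} → Vertex n → Vertex n → Pred (Vertex n) 0ℓ
PathNbhd a b v = v ≢ 𝟎 × v ≢ a × v ≢ b × (IsGen v ⊎ a ~ v ⊎ b ~ v)

pathNbhd? : ∀ {n} (a b : Vertex n) → Decidable (PathNbhd a b)
pathNbhd? a b v = ¬? (v ≟V 𝟎) ×-dec ¬? (v ≟V a) ×-dec ¬? (v ≟V b) ×-dec
  (isGen? v ⊎-dec isGen? (a ⊕ v) ⊎-dec isGen? (b ⊕ v))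

path-nbhd-swap : ∀ n (a b : Vertex n) → count n (pathNbhd? b a) ≤ count n (pathNbhd? a b)
path-nbhd-swap n a b = count-mono n _ _ λ (v≢𝟎 , v≢b , v≢a , nbr) → v≢𝟎 , v≢a , v≢b , ⊎-map id swap nbr

path-nbhd-true-false : ∀ m (a b : Vertex m) →
  count m (edgeNbhd? b) + count m isGen? ≤ count (suc m) (pathNbhd? (true ∷ a) (false ∷ b))
path-nbhd-true-false m a b = +-mono-≤ false-half true-half
  where
  false-half : count m (edgeNbhd? b) ≤ count m (pathNbhd? (true ∷ a) (false ∷ b) ∘ (false ∷_))
  false-half = count-mono m _ _ λ (w≢𝟎 , w≢b , nbr) →
    w≢𝟎 ∘ ∷-injectiveʳ , (λ ()) , w≢b ∘ ∷-injectiveʳ , [ inj₁ ∘ shift , inj₂ ∘ inj₂ ∘ shift ]′ nbr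
  true-half : count m isGen? ≤ count m (pathNbhd? (true ∷ a) (false ∷ b) ∘ (true ∷_))
  true-half = ≤-trans (≤-reflexive (sym (count-translate m isGen? a)))
    (count-mono m (isGen? ∘ (a ⊕_)) _ λ a~w →
      (λ ()) , ~⇒≢ a~w ∘ sym ∘ ∷-injectiveʳ , (λ ()) , inj₂ (inj₁ (shift a~w)))

path-nbhd-true-true : ∀ m (a b : Vertex m) →
  count m isGen? + count m (edgeNbhd? (a ⊕ b)) ≤ count (suc m) (pathNbhd? (true ∷ a) (true ∷ b))
path-nbhd-true-true m a b = +-mono-≤ false-half true-half
  where
  false-half : count m isGen? ≤ count m (pathNbhd? (true ∷ a) (true ∷ b) ∘ (false ∷_))
  false-half = count-mono m _ _ λ g → IsGen⇒≢𝟎 (shift g) , (λ ()) , (λ ()) , inj₁ (shift g)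
  member : ∀ {w} → EdgeNbhd (a ⊕ b) (a ⊕ w) → PathNbhd (true ∷ a) (true ∷ b) (true ∷ w)
  member {w} (a⊕w≢𝟎 , a⊕w≢a⊕b , nbr) =
    (λ ()) ,
    (λ e → a⊕w≢𝟎 (trans (cong (a ⊕_) (∷-injectiveʳ e)) (⊕-self a))) ,
    (λ e → a⊕w≢a⊕b (cong (a ⊕_) (∷-injectiveʳ e))) ,
    inj₂ ([ inj₁ ∘ shift , inj₂ ∘ shift ∘ subst IsGen (⊕-cancel-common a b w) ]′ nbr)
  true-half : count m (edgeNbhd? (a ⊕ b)) ≤ count m (pathNbhd? (true ∷ a) (true ∷ b) ∘ (true ∷_))
  true-half = ≤-trans (≤-reflexive (sym (count-translate m (edgeNbhd? (a ⊕ b)) a)))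
    (count-mono m (edgeNbhd? (a ⊕ b) ∘ (a ⊕_)) _ member)

path-nbhd-head-true : ∀ m {a : Vertex m} {b} → IsGen (true ∷ a) → IsGen b → true ∷ a ≢ b →
                      6 * suc m ≤ count (suc m) (pathNbhd? (true ∷ a) b) + 15
path-nbhd-head-true m {a} {false ∷ b} _ (shift gb) _ =
  gens+edge-bound m 8 (gens-lower m) (edge-nbhd-lower gb)
    (≤-trans (≤-reflexive (+-comm (count m isGen?) (count m (edgeNbhd? b)))) (path-nbhd-true-false m a b))
path-nbhd-head-true m {a} {true ∷ b} ga gb a≢b =
  gens+edge-bound m 8 (gens-lower m) (edge-nbhd-lower (low-gens-adjacent ga gb (a≢b ∘ cong (true ∷_))))
    (path-nbhd-true-true m a b)

path-nbhd-false-half : ∀ n (a b : Vertex n) →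
                       count n (pathNbhd? a b) ≤ count n (pathNbhd? (false ∷ a) (false ∷ b) ∘ (false ∷_))
path-nbhd-false-half n a b = count-mono n _ _ λ (v≢𝟎 , v≢a , v≢b , nbr) →
  v≢𝟎 ∘ ∷-injectiveʳ , v≢a ∘ ∷-injectiveʳ , v≢b ∘ ∷-injectiveʳ , ⊎-map shift (⊎-map shift shift) nbr

path-nbhd-true-half : ∀ m x₀ y₀ (s t : Vertex m) {ts} → Unique ts → All (λ u → u ≡ 𝟎 ⊎ u ≡ s ⊎ u ≡ t) ts →
  length ts + length ts ≤ count (suc m) (pathNbhd? (false ∷ x₀ ∷ s) (false ∷ y₀ ∷ t) ∘ (true ∷_))
path-nbhd-true-half m x₀ y₀ s t unique ts-ok =
  count-≥-lifts m (pathNbhd? (false ∷ x₀ ∷ s) (false ∷ y₀ ∷ t) ∘ (true ∷_)) unique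
    λ x → All.map (member x) ts-ok
  where
  member : ∀ x {u} → u ≡ 𝟎 ⊎ u ≡ s ⊎ u ≡ t → PathNbhd (false ∷ x₀ ∷ s) (false ∷ y₀ ∷ t) (true ∷ x ∷ u)
  member x (inj₁ refl) = (λ ()) , (λ ()) , (λ ()) , inj₁ (lowGen x)
  member x (inj₂ (inj₁ refl)) = (λ ()) , (λ ()) , (λ ()) , inj₂ (inj₁ (lowGen-⊕-self (x₀ xor x) s))
  member x (inj₂ (inj₂ refl)) = (λ ()) , (λ ()) , (λ ()) , inj₂ (inj₂ (lowGen-⊕-self (y₀ xor x) t))

path-nbhd-shift-head-true : ∀ m {a : Vertex m} {b} → IsGen (true ∷ a) → IsGen b → true ∷ a ≢ b →
  6 * suc (suc m) ≤ count (suc (suc m)) (pathNbhd? (false ∷ true ∷ a) (false ∷ b)) + 17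
path-nbhd-shift-head-true m {a} {false ∷ t} ga gb a≢b = ≤-next-dimension 6 (suc m) 17
  (path-nbhd-head-true m ga gb a≢b)
  (path-nbhd-false-half (suc m) (true ∷ a) (false ∷ t))
  (path-nbhd-true-half m true false a t (((IsGen⇒≢𝟎 (unshift gb) ∘ sym) ∷ []) ∷ [] ∷ [])
    (inj₁ refl ∷ inj₂ (inj₂ refl) ∷ []))
  ≤-refl
path-nbhd-shift-head-true m {a} {true ∷ t} ga gb a≢b = ≤-next-dimension 6 (suc m) 17
  (path-nbhd-head-true m ga gb a≢b)
  (path-nbhd-false-half (suc m) (true ∷ a) (true ∷ t))
  (path-nbhd-true-half m true true a t (((a≢b ∘ cong (true ∷_)) ∷ []) ∷ [] ∷ [])
    (inj₂ (inj₁ refl) ∷ inj₂ (inj₂ refl) ∷ []))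
  ≤-refl

path-nbhd-lower : ∀ {n} {a b : Vertex n} → IsGen a → IsGen b → a ≢ b → 6 * n ≤ count n (pathNbhd? a b) + 17
path-nbhd-lower {suc m} {true ∷ a} ga gb a≢b =
  ≤-trans (path-nbhd-head-true m ga gb a≢b) (+-monoʳ-≤ _ (m≤n+m 15 2))
path-nbhd-lower {suc m} {false ∷ a} {true ∷ b} ga gb a≢b =
  ≤-trans (path-nbhd-head-true m gb ga (a≢b ∘ sym))
          (+-mono-≤ (path-nbhd-swap (suc m) (false ∷ a) (true ∷ b)) (m≤n+m 15 2))
path-nbhd-lower {suc zero} {false ∷ []} (shift ())
path-nbhd-lower {suc (suc m)} {false ∷ true ∷ a} {false ∷ b} (shift ga) (shift gb) a≢b =
  path-nbhd-shift-head-true m ga gb (a≢b ∘ cong (false ∷_))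
path-nbhd-lower {suc (suc m)} {false ∷ false ∷ a} {false ∷ true ∷ b} (shift ga) (shift gb) a≢b =
  ≤-trans (path-nbhd-shift-head-true m gb ga (a≢b ∘ sym ∘ cong (false ∷_)))
    (+-monoˡ-≤ 17 (path-nbhd-swap (suc (suc m)) (false ∷ false ∷ a) (false ∷ true ∷ b)))
path-nbhd-lower {suc (suc m)} {false ∷ false ∷ a} {false ∷ false ∷ b} (shift ga) (shift gb) a≢b =
  ≤-next-dimension 6 (suc m) 17
  (path-nbhd-lower ga gb (a≢b ∘ cong (false ∷_)))
  (path-nbhd-false-half (suc m) (false ∷ a) (false ∷ b))
  (path-nbhd-true-half m false false a b distinct (inj₁ refl ∷ inj₂ (inj₁ refl) ∷ inj₂ (inj₂ refl) ∷ []))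
  ≤-refl
  where
  distinct : Unique (𝟎 ∷ a ∷ b ∷ [])
  distinct = (IsGen⇒≢𝟎 (unshift ga) ∘ sym ∷ IsGen⇒≢𝟎 (unshift gb) ∘ sym ∷ [])
           ∷ (a≢b ∘ cong (λ t → false ∷ false ∷ t) ∷ []) ∷ [] ∷ []

path-nbhd-top : ∀ m {a : Vertex (suc m)} → IsGen a → a ≢ unit (fromℕ m) →
                6 * suc m ≤ count (suc m) (pathNbhd? a (unit (fromℕ m))) + 15
path-nbhd-top m {true ∷ a} ga a≢top = path-nbhd-head-true m ga (unit-gen (fromℕ m)) a≢top
path-nbhd-top zero {false ∷ []} (shift ())
path-nbhd-top (suc zero) {false ∷ true ∷ []} _ a≢top = ⊥-elim (a≢top refl)
path-nbhd-top (suc zero) {false ∷ false ∷ []} (shift (shift ()))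
path-nbhd-top (suc (suc j)) {false ∷ true ∷ a} _ _ = ≤-next-dimension 6 (suc (suc j)) 15
  (gens+edge-bound (suc j) 6 (gens-lower (suc j)) (edge-nbhd-top j)
    (≤-trans (≤-reflexive (+-comm (count (suc j) isGen?) (count (suc j) (edgeNbhd? top))))
             (path-nbhd-true-false (suc j) a top)))
  (path-nbhd-false-half (suc (suc j)) (true ∷ a) (false ∷ top))
  (path-nbhd-true-half (suc j) true false a top (((IsGen⇒≢𝟎 (unit-gen (fromℕ j)) ∘ sym) ∷ []) ∷ [] ∷ [])
    (inj₁ refl ∷ inj₂ (inj₂ refl) ∷ []))
  ≤-refl
  where
  top = unit (fromℕ j)
path-nbhd-top (suc (suc j)) {false ∷ false ∷ a} (shift ga) a≢top =
  ≤-next-dimension 6 (suc (suc j)) 15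
  (path-nbhd-top (suc j) ga (a≢top ∘ cong (false ∷_)))
  (path-nbhd-false-half (suc (suc j)) (false ∷ a) (false ∷ top))
  (path-nbhd-true-half (suc j) false false a top distinct
    (inj₁ refl ∷ inj₂ (inj₁ refl) ∷ inj₂ (inj₂ refl) ∷ []))
  ≤-refl
  where
  top = unit (fromℕ j)
  distinct : Unique (𝟎 ∷ a ∷ top ∷ [])
  distinct = (IsGen⇒≢𝟎 (unshift ga) ∘ sym ∷ IsGen⇒≢𝟎 (unit-gen (fromℕ j)) ∘ sym ∷ [])
           ∷ (a≢top ∘ cong (λ t → false ∷ false ∷ t) ∷ []) ∷ [] ∷ []

-- Common neighbours in the Cayley graph

CommonNbr : ∀ {n} → Vertex n → Vertex n → Pred (Vertex n) 0ℓ
CommonNbr a b v = IsGen v × a ~ v × b ~ v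

lows-differ-by-e₀ : ∀ {m} {x g : Vertex (suc m)} →
                    IsGen (true ∷ x) → IsGen (true ∷ (x ⊕ g)) → IsGen g → g ≡ true ∷ 𝟎
lows-differ-by-e₀ {x = x₀ ∷ tx} {g₀ ∷ tg} gx gxg gg with low-tail gx
... | refl with trans (sym (⊕-identityˡ tg)) (low-tail gxg)
... | refl = cong (_∷ 𝟎) (head-true g₀ gg)
  where
  head-true : ∀ {m} x → IsGen (x ∷ 𝟎 {m}) → x ≡ true
  head-true true _ = refl
  head-true false (shift g) = ⊥-elim (¬IsGen-𝟎 g)

low-nbr-low : ∀ {m} a₁ {v : Vertex (suc m)} → IsGen (true ∷ v) → (true ∷ a₁ ∷ 𝟎) ~ (true ∷ v) →
              v ≡ not a₁ ∷ 𝟎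
low-nbr-low a₁ {v₁ ∷ t} gv a~v with low-tail gv
... | refl = cong (_∷ 𝟎) (¬-not λ v₁≡a₁ → ~⇒≢ a~v (cong (λ x → true ∷ x ∷ 𝟎) (sym v₁≡a₁)))

common-nbr-mixed : ∀ {m} a₁ {b : Vertex (suc (suc m))} {v w} → IsGen b → true ∷ a₁ ∷ 𝟎 ≢ b →
                   ¬ (CommonNbr (true ∷ a₁ ∷ 𝟎) b (true ∷ v) × CommonNbr (true ∷ a₁ ∷ 𝟎) b (false ∷ w))
common-nbr-mixed a₁ {true ∷ b₁ ∷ t} gb a≢b ((gv , a~v , b~v) , _) with low-tail gb
... | refl = a≢b (cong (λ x → true ∷ x ∷ 𝟎)
  (not-injective (∷-injectiveˡ (trans (sym (low-nbr-low a₁ gv a~v)) (low-nbr-low b₁ gv b~v)))))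
common-nbr-mixed a₁ {false ∷ b} {v} (shift gb) _ ((gv , _ , b~v) , (gw , a~w , b~w)) =
  ~⇒≢ (unshift b~w) (trans (lows-differ-by-e₀ gv (~-sym (false ∷ b) (true ∷ v) b~v) gb)
                           (sym (lows-differ-by-e₀ (lowGen a₁) a~w (unshift gw))))

common-nbr-unique-low : ∀ {m} a₁ {b v w : Vertex (suc (suc m))} → IsGen b → true ∷ a₁ ∷ 𝟎 ≢ b →
  CommonNbr (true ∷ a₁ ∷ 𝟎) b v → CommonNbr (true ∷ a₁ ∷ 𝟎) b w → v ≡ w
common-nbr-unique-low a₁ {v = true ∷ v} {true ∷ w} _ _ (gv , a~v , _) (gw , a~w , _) =
  cong (true ∷_) (trans (low-nbr-low a₁ gv a~v) (sym (low-nbr-low a₁ gw a~w)))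
common-nbr-unique-low a₁ {v = false ∷ v} {false ∷ w} _ _ (gv , a~v , _) (gw , a~w , _) =
  cong (false ∷_) (trans (lows-differ-by-e₀ (lowGen a₁) a~v (unshift gv))
                         (sym (lows-differ-by-e₀ (lowGen a₁) a~w (unshift gw))))
common-nbr-unique-low a₁ {v = true ∷ _} {false ∷ _} gb a≢b cv cw =
  ⊥-elim (common-nbr-mixed a₁ gb a≢b (cv , cw))
common-nbr-unique-low a₁ {v = false ∷ _} {true ∷ _} gb a≢b cv cw =
  ⊥-elim (common-nbr-mixed a₁ gb a≢b (cw , cv))

shifted-centres-no-low-nbr : ∀ {m} {a b v : Vertex (suc m)} → IsGen a → IsGen b → false ∷ a ≢ false ∷ b →
                             ¬ CommonNbr (false ∷ a) (false ∷ b) (true ∷ v)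
shifted-centres-no-low-nbr {a = a} {b} {v} ga gb a≢b (gv , a~v , b~v) =
  a≢b (cong (false ∷_) (trans (lows-differ-by-e₀ gv (~-sym (false ∷ a) (true ∷ v) a~v) ga)
                              (sym (lows-differ-by-e₀ gv (~-sym (false ∷ b) (true ∷ v) b~v) gb))))

common-nbr-unique : ∀ {n} {a b v w : Vertex n} → IsGen a → IsGen b → a ≢ b →
                    CommonNbr a b v → CommonNbr a b w → v ≡ w
common-nbr-unique {suc zero} {true ∷ []} {true ∷ []} _ _ a≢b = ⊥-elim (a≢b refl)
common-nbr-unique {suc zero} {false ∷ []} (shift ())
common-nbr-unique {suc zero} {true ∷ []} {false ∷ []} _ (shift ())
common-nbr-unique {suc (suc m)} {true ∷ a₁ ∷ _} ga gb a≢b with low-tail ga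
... | refl = common-nbr-unique-low a₁ gb a≢b
common-nbr-unique {suc (suc m)} {false ∷ _} {true ∷ b₁ ∷ _} ga gb a≢b cv cw with low-tail gb
... | refl = common-nbr-unique-low b₁ ga (a≢b ∘ sym) (swap-centres cv) (swap-centres cw)
  where
  swap-centres : ∀ {a b v : Vertex (suc (suc m))} → CommonNbr a b v → CommonNbr b a v
  swap-centres (gv , a~v , b~v) = gv , b~v , a~v
common-nbr-unique {suc (suc m)} {false ∷ _} {false ∷ _} {true ∷ _} (shift ga) (shift gb) a≢b cv _ =
  ⊥-elim (shifted-centres-no-low-nbr ga gb a≢b cv)
common-nbr-unique {suc (suc m)} {false ∷ _} {false ∷ _} {false ∷ _} {true ∷ _} (shift ga) (shift gb) a≢b _ cw =
  ⊥-elim (shifted-centres-no-low-nbr ga gb a≢b cw)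
common-nbr-unique {suc (suc m)} {false ∷ a} {false ∷ b} {false ∷ v} {false ∷ w} (shift ga) (shift gb) a≢b
  (gv , a~v , b~v) (gw , a~w , b~w) =
  cong (false ∷_) (common-nbr-unique ga gb (a≢b ∘ cong (false ∷_))
    (unshift gv , unshift a~v , unshift b~v) (unshift gw , unshift a~w , unshift b~w))

nbhdPathSize-lower : ∀ {n} (Y X Z : Vertex n) →
                     count n (pathNbhd? (coords X Y) (coords X Z)) ≤ nbhdPathSize Y X Z
nbhdPathSize-lower {n} Y X Z = begin
  count n (pathNbhd? a b)            ≡⟨ count-coords n (pathNbhd? a b) X ⟨
  count n (pathNbhd? a b ∘ coords X) ≤⟨ count-mono n _ (inNbhdPath? Y X Z) in-nbhd ⟩
  count n (inNbhdPath? Y X Z)        ≡⟨ count-filter n (inNbhdPath? Y X Z) ⟨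
  nbhdPathSize Y X Z                 ∎
  where
  open ≤-Reasoning
  a = coords X Y
  b = coords X Z
  in-nbhd : ∀ {W} → PathNbhd a b (coords X W) → InNbhdPath Y X Z W
  in-nbhd (W≢X , W≢Y , W≢Z , nbr) =
    (W≢Y ∘ cong (coords X) , (λ W≡X → W≢X (trans (cong (coords X) W≡X) (coords-self X))) ,
     W≢Z ∘ cong (coords X)) ,
    [ inj₂ ∘ inj₁ ∘ gen⇒adj , [ inj₁ ∘ coords~⇒adj X , inj₂ ∘ inj₂ ∘ coords~⇒adj X ]′ ]′ nbr

commonSize-≤-one : ∀ {n} {X Y Z : Vertex n} → Adj X Y → Adj X Z → Y ≢ Z → commonSize X Y Z ≤ 1
commonSize-≤-one {n} {X} {Y} {Z} adj-XY adj-XZ Y≢Z =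
  subst (_≤ 1) (sym (count-filter n (inCommon? X Y Z))) (count-≤-one n (inCommon? X Y Z) λ p q →
    coords-injective X (common-nbr-unique (adj⇒gen adj-XY) (adj⇒gen adj-XZ) (Y≢Z ∘ coords-injective X)
                                          (in-common p) (in-common q)))
  where
  in-common : ∀ {W} → InCommon X Y Z W → CommonNbr (coords X Y) (coords X Z) (coords X W)
  in-common (adj-XW , adj-YW , adj-ZW) = adj⇒gen adj-XW , adj⇒coords~ X adj-YW , adj⇒coords~ X adj-ZW

last-index : ∀ m (k : Fin (suc m)) → suc (toℕ k) ≡ suc m → k ≡ fromℕ m
last-index m k k-last = toℕ-injective (trans (suc-injective k-last) (sym (toℕ-fromℕ m)))

-- The bounds hold for every n.
lemma2p6 : (n : ℕ) → 5 ≤ n → (Y X Z : Vertex n) →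
    Adj X Y → Adj X Z → ¬ (Y ≡ Z) →
    (6 * n ∸ 17 ≤ nbhdPathSize Y X Z) ×
    (commonSize X Y Z ≤ 1) ×
    ((k : Fin n) → suc (toℕ k) ≡ n → Z ≡ flipUpTo k X → 6 * n ∸ 15 ≤ nbhdPathSize Y X Z)
lemma2p6 (suc m) _ Y X Z adj-XY adj-XZ Y≢Z =
  ∸-bound 17 (path-nbhd-lower gen-a gen-b a≢b) (nbhdPathSize-lower Y X Z) ,
  commonSize-≤-one adj-XY adj-XZ Y≢Z ,
  λ { k k-last refl → let b≡top = trans (coords-flipUpTo X k) (cong unit (last-index m k k-last)) in
      ∸-bound 15 (subst (λ t → 6 * suc m ≤ count (suc m) (pathNbhd? a t) + 15) (sym b≡top)
                        (path-nbhd-top m gen-a (subst (a ≢_) b≡top a≢b)))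
                 (nbhdPathSize-lower Y X Z) }
  where
  a = coords X Y
  b = coords X Z
  gen-a : IsGen a
  gen-a = adj⇒gen adj-XY
  gen-b : IsGen b
  gen-b = adj⇒gen adj-XZ
  a≢b : a ≢ b
  a≢b = Y≢Z ∘ coords-injective X
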